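{- If $G$ is a graph with $\xi(S_G^2)=\iota(S_G^2)$ and $t\ge 2$, then $\iota(S_G^t)\leq \iota(S_G^2)\, n(G)^{t-2}$.
   Context: All graphs are finite and simple, $n(G)=|V(G)|$. For a graph $G=(V,E)$ and integer $t\ge1$, the generalized Sierpiński graph $S_G^t$ has vertex set $V^t$ (words $u_1\ldots u_t$), and $u=u_1\ldots u_t$, $v=v_1\ldots v_t$ are adjacent iff there is $i\in[t]$ with $u_j=v_j$ for $j<i$, $u_i\ne v_i$ and $u_iv_i\in E$, and $u_j=v_i$, $v_j=u_i$ for all $j>i$. Vertices $xx\ldots x$ are extreme vertices. A set $A$ of vertices is isolating if no two vertices outside the closed neighborhood $N[A]$ are adjacent; $\iota$ is the minimum size of an isolating set and $\gamma$ the domination number. Let $\mathcal{I}(S_G^2)$ be the set of isolating sets $D$ of $S_G^2$ with $|D|\le\gamma(S_G^2)$, and $\xi(S_G^2)=\min\{|D|: D\in\mathcal{I}(S_G^2)$ such that whenever $ii,jj\in V(S_G^2)-N[D]$ we have $ij\notin E(G)\}$. -}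

module Defs where

open import Data.Nat using (ℕ; _≤_; _∸_; _^_; _*_)
open import Data.Fin using (Fin) renaming (_<_ to _<ᶠ_)
open import Data.Vec using (Vec; lookup; _∷_; [])
open import Data.List using (List; length)
open import Data.List.Membership.Propositional using (_∈_)
open import Data.Product using (Σ; ∃; _×_; _,_)
open import Data.Sum using (_⊎_)
open import Relation.Nullary using (¬_)
open import Relation.Binary.PropositionalEquality using (_≡_; _≢_)

record Graph : Set₁ where
  field
    n      : ℕ
    Adj    : Fin n → Fin n → Set
    sym    : ∀ {x y} → Adj x y → Adj y x
    irrefl : ∀ {x} → ¬ Adj x x
open Graph public

record RawGraph : Set₁ where
  field
    V    : Set
    Edge : V → V → Set
open RawGraph public

SAdj : (G : Graph) (t : ℕ) → Vec (Fin (n G)) t → Vec (Fin (n G)) t → Set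
SAdj G t u v =
  Σ (Fin t) λ i →
    (∀ j → j <ᶠ i → lookup u j ≡ lookup v j) ×
    (lookup u i ≢ lookup v i) ×
    Adj G (lookup u i) (lookup v i) ×
    (∀ j → i <ᶠ j → (lookup u j ≡ lookup v i) × (lookup v j ≡ lookup u i))

Sierpinski : Graph → ℕ → RawGraph
Sierpinski G t = record { V = Vec (Fin (n G)) t ; Edge = SAdj G t }

module _ (H : RawGraph) where
  -- vertex sets are represented by lists of vertices; |D| = length D
  -- v ∈ N[D]
  InN : List (V H) → V H → Set
  InN D v = (v ∈ D) ⊎ (∃ λ u → u ∈ D × Edge H u v)

  Isolating : List (V H) → Set
  Isolating D = ∀ u v → ¬ InN D u → ¬ InN D v → ¬ Edge H u v

  Dominating : List (V H) → Set
  Dominating D = ∀ v → InN D v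

  IsIota : ℕ → Set
  IsIota k = (∃ λ D → Isolating D × length D ≡ k)
           × (∀ D → Isolating D → k ≤ length D)

  IsGamma : ℕ → Set
  IsGamma k = (∃ λ D → Dominating D × length D ≡ k)
            × (∀ D → Dominating D → k ≤ length D)

diag2 : (G : Graph) → Fin (n G) → Vec (Fin (n G)) 2
diag2 G i = i ∷ i ∷ []

-- the sets D ∈ 𝓘(S_G^2) (given γ(S_G^2) = g) satisfying the extra ξ-condition
XiAdmissible : (G : Graph) → ℕ → List (Vec (Fin (n G)) 2) → Set
XiAdmissible G g D =
  Isolating (Sierpinski G 2) D × length D ≤ g ×
  (∀ i j → ¬ InN (Sierpinski G 2) D (diag2 G i)
         → ¬ InN (Sierpinski G 2) D (diag2 G j) → ¬ Adj G i j)

IsXi : (G : Graph) → (g k : ℕ) → Set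
IsXi G g k = (∃ λ D → XiAdmissible G g D × length D ≡ k)
           × (∀ D → XiAdmissible G g D → k ≤ length D)

-- Call a vertex set D of S_G^t ξ-isolating if it is isolating and any two extreme vertices
-- ii…i, jj…j outside N[D] satisfy ij ∉ E(G). Taking a copy of D in every subgraph aS_G^t
-- of S_G^(t+1) gives a ξ-isolating set of n(G)·|D| vertices: an edge inside a copy aS_G^t is
-- handled by D being isolating, and the only other edges are the bridges ab…b ~ ba…a with
-- ab ∈ E(G), whose ends lie outside N[copies of D] only if the extreme vertices b…b, a…a
-- of S_G^t lie outside N[D]. Iterating from a ξ-isolating set of S_G^2 of size ξ = ι gives
-- an isolating set of S_G^t of size ι·n(G)^(t-2).
module Submission where

open import Defs hiding (sym)
open import Data.Nat using (ℕ; zero; suc; _+_; _≤_; _∸_; _^_; _*_; s≤s; z≤n)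
open import Data.Nat.Properties using (≤-trans; ≤-reflexive; +-comm; +-identityʳ; *-comm; *-assoc)
open import Data.Fin using (Fin; zero; suc) renaming (_<_ to _<ᶠ_)
open import Data.Vec using (Vec; _∷_; []; replicate; lookup)
open import Data.List using (List; _∷_; []; _++_; map; length; allFin; cartesianProductWith)
open import Data.List.Properties using (length-++; length-map; length-tabulate)
open import Data.List.Membership.Propositional.Properties using (∈-cartesianProductWith⁺; ∈-allFin)
open import Data.Product using (_×_; _,_; proj₁; proj₂)
open import Data.Sum using (_⊎_; inj₁; inj₂)
open import Function using (_∘_; id)
open import Relation.Nullary using (¬_)
open import Relation.Binary.PropositionalEquality using (_≡_; refl; cong; cong₂; subst; sym)
open Relation.Binary.PropositionalEquality.≡-Reasoning

length-cartesianProductWith : ∀ {A B C : Set} (f : A → B → C) xs ys →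
  length (cartesianProductWith f xs ys) ≡ length xs * length ys
length-cartesianProductWith f []       ys = refl
length-cartesianProductWith f (x ∷ xs) ys = begin
  length (map (f x) ys ++ cartesianProductWith f xs ys)
    ≡⟨ length-++ (map (f x) ys) ⟩
  length (map (f x) ys) + length (cartesianProductWith f xs ys)
    ≡⟨ cong₂ _+_ (length-map (f x) ys) (length-cartesianProductWith f xs ys) ⟩
  length ys + length xs * length ys
    ∎

lookup-const⇒≡replicate : ∀ {A : Set} {t} (u : Vec A t) b → (∀ k → lookup u k ≡ b) → u ≡ replicate t b
lookup-const⇒≡replicate []      b u≗b = refl
lookup-const⇒≡replicate (_ ∷ u) b u≗b = cong₂ _∷_ (u≗b zero) (lookup-const⇒≡replicate u b (u≗b ∘ suc))

module _ (G : Graph) where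

  private
    Word : ℕ → Set
    Word t = Vec (Fin (n G)) t

    S : ℕ → RawGraph
    S = Sierpinski G

  ExtremesIndependent : ∀ t → List (Word t) → Set
  ExtremesIndependent t D =
    ∀ i j → ¬ InN (S t) D (replicate t i) → ¬ InN (S t) D (replicate t j) → ¬ Adj G i j

  XiIsolating : ∀ t → List (Word t) → Set
  XiIsolating t D = Isolating (S t) D × ExtremesIndependent t D

  SAdj-∷⁺ : ∀ {t} a {u v : Word t} → SAdj G t u v → SAdj G (suc t) (a ∷ u) (a ∷ v)
  SAdj-∷⁺ a {u} {v} (i , before , ≢ , adj , after) = suc i , before′ , ≢ , adj , after′
    where
    before′ : ∀ j → j <ᶠ suc i → lookup (a ∷ u) j ≡ lookup (a ∷ v) j
    before′ zero    _         = refl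
    before′ (suc j) (s≤s j<i) = before j j<i
    after′ : ∀ j → suc i <ᶠ j → lookup (a ∷ u) j ≡ lookup v i × lookup (a ∷ v) j ≡ lookup u i
    after′ (suc j) (s≤s i<j) = after j i<j

  SAdj-∷⁻ : ∀ {t a b} {u v : Word t} → SAdj G (suc t) (a ∷ u) (b ∷ v) →
    (Adj G a b × u ≡ replicate t b × v ≡ replicate t a) ⊎ SAdj G t u v
  SAdj-∷⁻ {a = a} {b} {u} {v} (zero , _ , _ , adj , after) =
    inj₁ (adj , lookup-const⇒≡replicate u b (proj₁ ∘ swapped)
              , lookup-const⇒≡replicate v a (proj₂ ∘ swapped))
    where
    swapped : ∀ k → lookup u k ≡ b × lookup v k ≡ a
    swapped k = after (suc k) (s≤s z≤n)
  SAdj-∷⁻ (suc i , before , ≢ , adj , after) =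
    inj₂ (i , (λ j j<i → before (suc j) (s≤s j<i)) , ≢ , adj , (λ j i<j → after (suc j) (s≤s i<j)))

  copies : ∀ {t} → List (Word t) → List (Word (suc t))
  copies = cartesianProductWith _∷_ (allFin (n G))

  length-copies : ∀ {t} (D : List (Word t)) → length (copies D) ≡ n G * length D
  length-copies D = begin
    length (copies D)                ≡⟨ length-cartesianProductWith _∷_ (allFin (n G)) D ⟩
    length (allFin (n G)) * length D ≡⟨ cong (_* length D) (length-tabulate {n = n G} id) ⟩
    n G * length D                   ∎

  InN-copies⁺ : ∀ {t} (D : List (Word t)) a {u} → InN (S t) D u → InN (S (suc t)) (copies D) (a ∷ u)
  InN-copies⁺ D a (inj₁ u∈D)           = inj₁ (∈-cartesianProductWith⁺ _∷_ (∈-allFin a) u∈D)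
  InN-copies⁺ D a (inj₂ (d , d∈D , e)) =
    inj₂ (a ∷ d , ∈-cartesianProductWith⁺ _∷_ (∈-allFin a) d∈D , SAdj-∷⁺ a e)

  copies-xiIsolating : ∀ {t} (D : List (Word t)) → XiIsolating t D → XiIsolating (suc t) (copies D)
  copies-xiIsolating {t} D (isolating , independent) = isolating′ , independent′
    where
    lift∉ : ∀ a {u} → ¬ InN (S (suc t)) (copies D) (a ∷ u) → ¬ InN (S t) D u
    lift∉ a a∷u∉ = a∷u∉ ∘ InN-copies⁺ D a

    isolating′ : Isolating (S (suc t)) (copies D)
    isolating′ (a ∷ u) (b ∷ v) a∷u∉ b∷v∉ e with SAdj-∷⁻ e
    ... | inj₁ (ab , refl , refl) = independent a b (lift∉ b b∷v∉) (lift∉ a a∷u∉) ab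
    ... | inj₂ e′                 = isolating u v (lift∉ a a∷u∉) (lift∉ b b∷v∉) e′

    independent′ : ExtremesIndependent (suc t) (copies D)
    independent′ i j i∉ j∉ = independent i j (lift∉ i i∉) (lift∉ j j∉)

  iterateCopies : ∀ {t} m → List (Word t) → List (Word (m + t))
  iterateCopies zero    D = D
  iterateCopies (suc m) D = copies (iterateCopies m D)

  iterateCopies-xiIsolating : ∀ {t} m (D : List (Word t)) →
    XiIsolating t D → XiIsolating (m + t) (iterateCopies m D)
  iterateCopies-xiIsolating zero    D ξD = ξD
  iterateCopies-xiIsolating (suc m) D ξD = copies-xiIsolating _ (iterateCopies-xiIsolating m D ξD)

  length-iterateCopies : ∀ {t} m (D : List (Word t)) → length (iterateCopies m D) ≡ n G ^ m * length D
  length-iterateCopies zero    D = sym (+-identityʳ (length D))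
  length-iterateCopies (suc m) D = begin
    length (copies (iterateCopies m D)) ≡⟨ length-copies (iterateCopies m D) ⟩
    n G * length (iterateCopies m D)    ≡⟨ cong (n G *_) (length-iterateCopies m D) ⟩
    n G * (n G ^ m * length D)          ≡⟨ sym (*-assoc (n G) (n G ^ m) (length D)) ⟩
    n G ^ suc m * length D              ∎

  xiIsolating⇒ι≤ : ∀ {t ι} m (D : List (Word t)) →
    IsIota (S (m + t)) ι → XiIsolating t D → ι ≤ n G ^ m * length D
  xiIsolating⇒ι≤ m D (_ , minimal) ξD =
    ≤-trans (minimal (iterateCopies m D) (iterateCopies-xiIsolating m D ξD .proj₁))
            (≤-reflexive (length-iterateCopies m D))

corollary5p2 : (G : Graph) (t g ι₂ ξ₂ ιₜ : ℕ) → 2 ≤ t →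
    IsGamma (Sierpinski G 2) g → IsIota (Sierpinski G 2) ι₂ → IsXi G g ξ₂ →
    ξ₂ ≡ ι₂ → IsIota (Sierpinski G t) ιₜ →
    ιₜ ≤ ι₂ * (n G ^ (t ∸ 2))
corollary5p2 G (suc (suc m)) g ι₂ .ι₂ ιₜ (s≤s (s≤s z≤n)) _ _
             ((D , (isolating , _ , independent) , |D|≡ι₂) , _) refl ιₜ-is =
  ≤-trans (xiIsolating⇒ι≤ G m D ιₜ-is′ (isolating , independent)) (≤-reflexive (begin
    n G ^ m * length D ≡⟨ cong (n G ^ m *_) |D|≡ι₂ ⟩
    n G ^ m * ι₂       ≡⟨ *-comm (n G ^ m) ι₂ ⟩
    ι₂ * n G ^ m       ∎))
  where
  ιₜ-is′ : IsIota (Sierpinski G (m + 2)) ιₜ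
  ιₜ-is′ = subst (λ k → IsIota (Sierpinski G k) ιₜ) (+-comm 2 m) ιₜ-is
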